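{- Let $q\ge 2$ and $n\ge 1$ be integers. Under each of the scenarios $(\circ *)$ and $(* *)$, the family $\mathcal{E}_q=\{x\mapsto [\![x=t]\!]\}_{t\in[q\rangle}$ is $n$-cell implementable if and only if $q\le 2^n$.
   Context: For integers $a\le b$, $[b\rangle=\{0,1,\ldots,b-1\}$. Let $\mathbb{B}=\{0,1\}$, $\mathbb{B}_\circ=\mathbb{B}$, $\mathbb{B}_*=\mathbb{B}\cup\{*\}$, $\mathbb{B}_\bullet=\mathbb{B}\cup\{*,\bullet\}$. Define $\mathrm{T}:\mathbb{B}_\bullet^2\to\mathbb{B}$ by $\mathrm{T}(u,\vartheta)=1$ if and only if $u=*$, or $\vartheta=*$, or $u=\vartheta\in\mathbb{B}$ (so in particular $\mathrm{T}(\bullet,\vartheta)=0$ unless $\vartheta=*$, and $\mathrm{T}(\bullet,\bullet)=0$). $[\![\cdot]\!]$ is the Iverson bracket. $\mathcal{F}_q$ is the set of all functions $[q\rangle\to\mathbb{B}$. For $\alpha,\beta\in\{\circ,*,\bullet\}$, a subset $\Phi\subseteq\mathcal{F}_q$ is $n$-cell implementable under scenario $(\alpha\beta)$ if there exist mappings $\mathbf{u}=(u_j)_{j\in[n\rangle}:[q\rangle\to\mathbb{B}_\alpha^n$ and $\boldsymbol{\vartheta}=(\vartheta_j)_{j\in[n\rangle}:\Phi\to\mathbb{B}_\beta^n$ such that $f(x)=\bigwedge_{j\in[n\rangle}\mathrm{T}(u_j(x),\vartheta_j(f))$ for all $f\in\Phi$ and all $x\in[q\rangle$. -}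

module Defs where

open import Data.Nat using (ℕ; zero; suc; _^_)
open import Data.Fin using (Fin; zero; suc; _≟_)
open import Data.Bool using (Bool; true; false; _∧_)
open import Data.Product using (Σ; _×_)
open import Relation.Binary.PropositionalEquality using (_≡_)
open import Relation.Nullary.Decidable using (⌊_⌋)

data B• : Set where
  b0 b1 star bullet : B•

data Scen : Set where
  ∘ ⋆ • : Scen

data Alph : Scen → Set where
  bit  : ∀ {α} → Bool → Alph α
  star⋆ : Alph ⋆
  star• : Alph •
  bul•  : Alph •

emb : ∀ {α} → Alph α → B•
emb (bit false) = b0
emb (bit true)  = b1
emb star⋆ = star
emb star• = star
emb bul•  = bullet

T : B• → B• → Bool
T star _    = true
T _ star    = true
T b0 b0     = true
T b1 b1     = true
T _ _       = false

bigAnd : (n : ℕ) → (Fin n → Bool) → Bool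
bigAnd zero    g = true
bigAnd (suc n) g = g zero ∧ bigAnd n (λ i → g (suc i))

-- 𝓕_q : functions [q⟩ → 𝔹.  A family Φ ⊆ 𝓕_q is given as an indexed family
-- Φ : I → 𝓕_q (for 𝓔_q the indexing t ↦ [[x = t]] is injective).
𝓕 : ℕ → Set
𝓕 q = Fin q → Bool

Implementable : (α β : Scen) (q n : ℕ) {I : Set} → (I → 𝓕 q) → Set
Implementable α β q n {I} Φ =
  Σ (Fin q → Fin n → Alph α) λ u →
  Σ (I → Fin n → Alph β) λ ϑ →
  ∀ (i : I) (x : Fin q) →
    Φ i x ≡ bigAnd n (λ j → T (emb (u x j)) (emb (ϑ i j)))

𝓔 : (q : ℕ) → Fin q → 𝓕 q
𝓔 q t x = ⌊ x ≟ t ⌋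

{-# OPTIONS --safe #-}
-- A cell fixed to a bit in both u and ϑ tests one bit of equality, so q ≤ 2ⁿ
-- points can be told apart by their binary addresses. Conversely, without the
-- symbol •, every cell j of a point t carries a bit compatible with both u t j
-- and ϑ t j (u t j if it is a bit, else ϑ t j if that is, else anything). If
-- s ≠ t, some cell j rejects s, i.e. u s j and ϑ t j are opposite bits, and
-- then these compatible bits of s and t differ at j. The resulting words in
-- 𝔹ⁿ are pairwise distinct, whence q ≤ 2ⁿ.
module Submission where

open import Defs
open import Data.Bool using (Bool; true; false; not)
open import Data.Bool.Properties using (not-¬; ¬-not)
open import Data.Fin using (Fin; zero; suc; _≟_; inject≤; combine; funToFin; finToFun)
open import Data.Fin.Properties
  using (2↔Bool; injective⇒≤; inject≤-injective; funToFin-finToFin; finToFun-funToFin)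
open import Data.Nat using (ℕ; zero; suc; _≤_; _^_)
open import Data.Product using (Σ; _×_; _,_)
open import Function.Bundles using (_⇔_; mk⇔; Inverse)
open import Relation.Binary.PropositionalEquality
open import Relation.Nullary using (yes; no; contradiction)
open import Relation.Nullary.Decidable using (isYes≗does; dec-true; dec-false)

open Inverse 2↔Bool using (to; from; strictlyInverseˡ; strictlyInverseʳ)

bigAnd≡true⇒all : ∀ n {g : Fin n → Bool} → bigAnd n g ≡ true → ∀ j → g j ≡ true
bigAnd≡true⇒all (suc n) {g} e j with g zero in g0
bigAnd≡true⇒all (suc n) e zero    | true = g0
bigAnd≡true⇒all (suc n) e (suc j) | true = bigAnd≡true⇒all n e j

all⇒bigAnd≡true : ∀ n {g : Fin n → Bool} → (∀ j → g j ≡ true) → bigAnd n g ≡ true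
all⇒bigAnd≡true zero    h = refl
all⇒bigAnd≡true (suc n) h rewrite h zero = all⇒bigAnd≡true n (λ j → h (suc j))

bigAnd≡false⇒any : ∀ n {g : Fin n → Bool} → bigAnd n g ≡ false → Σ (Fin n) λ j → g j ≡ false
bigAnd≡false⇒any (suc n) {g} e with g zero in g0
... | false = zero , g0
... | true  with bigAnd≡false⇒any n e
...   | j , gj = suc j , gj

𝓔-self : ∀ {q} (t : Fin q) → 𝓔 q t t ≡ true
𝓔-self t = trans (isYes≗does (t ≟ t)) (dec-true (t ≟ t) refl)

𝓔-≢ : ∀ {q} {t x : Fin q} → x ≢ t → 𝓔 q t x ≡ false
𝓔-≢ {t = t} {x} x≢t = trans (isYes≗does (x ≟ t)) (dec-false (x ≟ t) x≢t)

funToFin-cong : ∀ {m k} {f g : Fin m → Fin k} → (∀ j → f j ≡ g j) → funToFin f ≡ funToFin g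
funToFin-cong {zero}  h = refl
funToFin-cong {suc m} h = cong₂ combine (h zero) (funToFin-cong (λ j → h (suc j)))

module BinaryWords {n : ℕ} where

  encode : (Fin n → Bool) → Fin (2 ^ n)
  encode w = funToFin (λ j → from (w j))

  decode : Fin (2 ^ n) → Fin n → Bool
  decode k j = to (finToFun k j)

  decode-encode : ∀ w j → decode (encode w) j ≡ w j
  decode-encode w j = trans (cong to (finToFun-funToFin (λ i → from (w i)) j)) (strictlyInverseˡ (w j))

  encode-decode : ∀ k → encode (decode k) ≡ k
  encode-decode k =
    trans (funToFin-cong {n} {2} (λ j → strictlyInverseʳ (finToFun k j))) (funToFin-finToFin {n} {2} k)

  decode-injective : ∀ {k l} → (∀ j → decode k j ≡ decode l j) → k ≡ l
  decode-injective {k} {l} h = begin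
    k                   ≡⟨ sym (encode-decode k) ⟩
    encode (decode k)   ≡⟨ funToFin-cong (λ j → cong from (h j)) ⟩
    encode (decode l)   ≡⟨ encode-decode l ⟩
    l                   ∎
    where open ≡-Reasoning

open BinaryWords

T-bit⇒≡ : ∀ {α β} a b → T (emb {α} (bit a)) (emb {β} (bit b)) ≡ true → a ≡ b
T-bit⇒≡ false false _ = refl
T-bit⇒≡ true  true  _ = refl

T-bit-refl : ∀ {α β} a → T (emb {α} (bit a)) (emb {β} (bit a)) ≡ true
T-bit-refl false = refl
T-bit-refl true  = refl

≤⇒implementable : ∀ {α β q n} → q ≤ 2 ^ n → Implementable α β q n (𝓔 q)
≤⇒implementable {α} {β} {q} {n} q≤2ⁿ = (λ x j → bit (address x j)) , (λ t j → bit (address t j)) , correct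
  where
  address : Fin q → Fin n → Bool
  address x = decode (inject≤ x q≤2ⁿ)

  address-injective : ∀ {x t} → (∀ j → address x j ≡ address t j) → x ≡ t
  address-injective h = inject≤-injective q≤2ⁿ q≤2ⁿ _ _ (decode-injective h)

  correct : ∀ t x →
    𝓔 q t x ≡ bigAnd n (λ j → T (emb {α} (bit (address x j))) (emb {β} (bit (address t j))))
  correct t x with x ≟ t
  ... | yes refl = sym (all⇒bigAnd≡true n (λ j → T-bit-refl (address x j)))
  ... | no x≢t   = sym (¬-not λ accepted → x≢t (address-injective λ j →
                      T-bit⇒≡ (address x j) (address t j) (bigAnd≡true⇒all n accepted j)))

BulletFree : Scen → Set
BulletFree α = (a : Alph α) → emb a ≢ bullet

bulletFree-∘ : BulletFree ∘
bulletFree-∘ (bit false) ()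
bulletFree-∘ (bit true)  ()

bulletFree-⋆ : BulletFree ⋆
bulletFree-⋆ (bit false) ()
bulletFree-⋆ (bit true)  ()
bulletFree-⋆ star⋆       ()

commonBit : B• → B• → Bool
commonBit b0 _  = false
commonBit b1 _  = true
commonBit _  b0 = false
commonBit _  b1 = true
commonBit _  _  = false

T≡false⇒opposite-bits : ∀ {a c} → a ≢ bullet → c ≢ bullet → T a c ≡ false →
  Σ Bool λ x → a ≡ emb {∘} (bit x) × c ≡ emb {∘} (bit (not x))
T≡false⇒opposite-bits {b0}     {b1}     _ _ _ = false , refl , refl
T≡false⇒opposite-bits {b1}     {b0}     _ _ _ = true , refl , refl
T≡false⇒opposite-bits {b0}     {bullet} _ c• _ = contradiction refl c•
T≡false⇒opposite-bits {b1}     {bullet} _ c• _ = contradiction refl c•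
T≡false⇒opposite-bits {bullet} {_}      a• _ _ = contradiction refl a•
T≡false⇒opposite-bits {b0}     {b0}     _ _ ()
T≡false⇒opposite-bits {b0}     {star}   _ _ ()
T≡false⇒opposite-bits {b1}     {b1}     _ _ ()
T≡false⇒opposite-bits {b1}     {star}   _ _ ()
T≡false⇒opposite-bits {star}   {_}      _ _ ()

commonBit-bit : ∀ x d → commonBit (emb {∘} (bit x)) d ≡ x
commonBit-bit false _ = refl
commonBit-bit true  _ = refl

T≡true⇒commonBit : ∀ b y → T b (emb {∘} (bit y)) ≡ true → commonBit b (emb {∘} (bit y)) ≡ y
T≡true⇒commonBit b0   false _ = refl
T≡true⇒commonBit b1   true  _ = refl
T≡true⇒commonBit star false _ = refl
T≡true⇒commonBit star true  _ = refl

commonBit-separates : ∀ {a b c} d → a ≢ bullet → c ≢ bullet →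
  T a c ≡ false → T b c ≡ true → commonBit a d ≢ commonBit b c
commonBit-separates {b = b} d a• c• rejected accepted
  with T≡false⇒opposite-bits a• c• rejected
... | x , refl , refl =
  subst₂ _≢_ (sym (commonBit-bit x d)) (sym (T≡true⇒commonBit b (not x) accepted)) (not-¬ refl)

implementable⇒≤ : ∀ {α β q n} → BulletFree α → BulletFree β →
  Implementable α β q n (𝓔 q) → q ≤ 2 ^ n
implementable⇒≤ {q = q} {n} freeα freeβ (u , ϑ , implements) =
  injective⇒≤ {f = λ t → encode (word t)} word-injective
  where
  word : Fin q → Fin n → Bool
  word t j = commonBit (emb (u t j)) (emb (ϑ t j))

  word-injective : ∀ {s t} → encode (word s) ≡ encode (word t) → s ≡ t
  word-injective {s} {t} same with t ≟ s
  ... | yes t≡s = sym t≡s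
  ... | no t≢s with bigAnd≡false⇒any n (trans (sym (implements t s)) (𝓔-≢ λ s≡t → t≢s (sym s≡t)))
  ...   | j , rejected = contradiction (word-agrees j) (commonBit-separates
            (emb (ϑ s j)) (freeα (u s j)) (freeβ (ϑ t j)) rejected
            (bigAnd≡true⇒all n (trans (sym (implements t t)) (𝓔-self t)) j))
    where
    word-agrees : ∀ j → word s j ≡ word t j
    word-agrees j = begin
      word s j                   ≡⟨ sym (decode-encode (word s) j) ⟩
      decode (encode (word s)) j ≡⟨ cong (λ k → decode k j) same ⟩
      decode (encode (word t)) j ≡⟨ decode-encode (word t) j ⟩
      word t j                   ∎
      where open ≡-Reasoning

proposition4 : (q n : ℕ) → 2 ≤ q → 1 ≤ n →
    (Implementable ∘ ⋆ q n (𝓔 q) ⇔ q ≤ 2 ^ n) × (Implementable ⋆ ⋆ q n (𝓔 q) ⇔ q ≤ 2 ^ n)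
proposition4 q n _ _ =
  mk⇔ (implementable⇒≤ bulletFree-∘ bulletFree-⋆) ≤⇒implementable ,
  mk⇔ (implementable⇒≤ bulletFree-⋆ bulletFree-⋆) ≤⇒implementable
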